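{- Let $\Gamma=\langle\alpha_1,\ldots,\alpha_k\rangle\subset\mathbb N^d$ be a full affine semigroup, let $A$ be the $d\times k$ matrix with columns $\alpha_1,\ldots,\alpha_k$, and fix $i\le k$. Let $H$ be the set of those minimal elements (with respect to the componentwise order $\le$) of $\{x\in\mathbb N^k: Ax\ge\alpha_i\}$ that satisfy $z_i=0$. If $H=\emptyset$ then $\mathsf t_i(\Gamma)=0$. Otherwise, for each $z\in H$ let $y^{(z)}$ be a minimizer of $y_1+\cdots+y_k$ over $\{y\in\mathbb N^k: Ay=Az,\ y\cdot z=0,\ y_i\ge1\}$; then $$\mathsf t_i(\Gamma)=\max\{|z|,|y^{(z)}|: z\in H\}.$$
   Context: An affine semigroup is a finitely generated submonoid of $\mathbb N^d$ with minimal generating set $\alpha_1,\ldots,\alpha_k$; it is full if $\mathrm G(\Gamma)\cap\mathbb N^d=\Gamma$, where $\mathrm G(\Gamma)$ is the subgroup of $\mathbb Z^d$ generated by $\Gamma$. Inequalities between vectors are componentwise. $\varphi_\Gamma(z)=Az$, $\mathsf Z(\gamma)=\varphi_\Gamma^{ -1}(\gamma)$, $|z|=z_1+\cdots+z_k$, $\gcd(z,w)=(\min(z_l,w_l))_l$, $\mathrm{dist}(z,w)=\max(|z-\gcd(z,w)|,|w-\gcd(z,w)|)$. For $\gamma\in\Gamma$ with $\gamma-\alpha_i\in\Gamma$, $\mathsf t_i(\gamma)$ is the least $N\in\mathbb N\cup\{\infty\}$ such that for every $z\in\mathsf Z(\gamma)$ there is $w\in\mathsf Z(\gamma)$ with $w_i>0$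 and $\mathrm{dist}(z,w)\le N$; and $\mathsf t_i(\Gamma)=\sup\{\mathsf t_i(\gamma):\gamma-\alpha_i\in\Gamma\}$. -}

module Defs where

open import Data.Nat using (ℕ; zero; suc; _+_; _*_; _∸_; _≤_; _<_; _⊔_; _⊓_)
open import Data.Integer as ℤ using (ℤ; +_)
open import Data.Fin using (Fin; zero; suc)
open import Data.Product using (Σ; ∃; ∃-syntax; _×_; _,_)
open import Data.Sum using (_⊎_)
open import Data.Empty using (⊥)
open import Relation.Nullary using (¬_)
open import Relation.Binary.PropositionalEquality using (_≡_)

Vecℕ : ℕ → Set
Vecℕ n = Fin n → ℕ

∑ : ∀ {n} → (Fin n → ℕ) → ℕ
∑ {zero}  f = 0
∑ {suc n} f = f zero + ∑ (λ j → f (suc j))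

∑ℤ : ∀ {n} → (Fin n → ℤ) → ℤ
∑ℤ {zero}  f = + 0
∑ℤ {suc n} f = f zero ℤ.+ ∑ℤ (λ j → f (suc j))

_≋_ : ∀ {n} → Vecℕ n → Vecℕ n → Set
x ≋ y = ∀ l → x l ≡ y l

_≤ᵥ_ : ∀ {n} → Vecℕ n → Vecℕ n → Set
x ≤ᵥ y = ∀ l → x l ≤ y l

∣_∣ : ∀ {k} → Vecℕ k → ℕ
∣ z ∣ = ∑ z

_·_ : ∀ {k} → Vecℕ k → Vecℕ k → ℕ
y · z = ∑ (λ j → y j * z j)

module _ {d k : ℕ} (α : Fin k → Vecℕ d) where

  φ : Vecℕ k → Vecℕ d
  φ z l = ∑ (λ j → z j * α j l)

  _∈Γ : Vecℕ d → Set
  γ ∈Γ = ∃[ z ] (φ z ≋ γ)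

  IsMinimalGeneratingSet : Set
  IsMinimalGeneratingSet =
    ∀ j → (¬ (∀ l → α j l ≡ 0)) × (¬ (∃[ z ] (z j ≡ 0 × φ z ≋ α j)))

  _∈GΓ : (Fin d → ℤ) → Set
  x ∈GΓ = Σ (Fin k → ℤ) λ c → (∀ l → ∑ℤ (λ j → c j ℤ.* (+ α j l)) ≡ x l)

  IsFull : Set
  IsFull = ∀ (x : Vecℕ d) → (λ l → + x l) ∈GΓ → x ∈Γ

  _∈Z_ : Vecℕ k → Vecℕ d → Set
  z ∈Z γ = φ z ≋ γ

  gcdᶻ : Vecℕ k → Vecℕ k → Vecℕ k
  gcdᶻ z w l = z l ⊓ w l

  dist : Vecℕ k → Vecℕ k → ℕ
  dist z w = ∣ (λ l → z l ∸ gcdᶻ z w l) ∣ ⊔ ∣ (λ l → w l ∸ gcdᶻ z w l) ∣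

  Admissible : Fin k → Vecℕ d → Set
  Admissible i γ = (α i ≤ᵥ γ) × ((λ l → γ l ∸ α i l) ∈Γ)

  -- the defining property of t_i(γ) ≤ N
  TameBound : Fin k → Vecℕ d → ℕ → Set
  TameBound i γ N =
    ∀ z → z ∈Z γ → ∃[ w ] (w ∈Z γ × 0 < w i × dist z w ≤ N)

  -- t_i(γ) = N  (N the least natural number with the property;
  -- if no such N exists, t_i(γ) = ∞ and this relation holds for no N)
  TiElemIs : Fin k → Vecℕ d → ℕ → Set
  TiElemIs i γ N = TameBound i γ N × (∀ N' → TameBound i γ N' → N ≤ N')

  TiBoundedBy : Fin k → ℕ → Set
  TiBoundedBy i m = ∀ γ → Admissible i γ → ∃[ N ] (TiElemIs i γ N × N ≤ m)

  -- t_i(Γ) = sup{ t_i(γ) : γ − α_i ∈ Γ } = m  (m ∈ ℕ)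
  TiIs : Fin k → ℕ → Set
  TiIs i m = TiBoundedBy i m × (∀ m' → TiBoundedBy i m' → m ≤ m')

  InS : Fin k → Vecℕ k → Set
  InS i x = α i ≤ᵥ φ x

  InH : Fin k → Vecℕ k → Set
  InH i z = InS i z × (∀ x → InS i x → x ≤ᵥ z → x ≋ z) × z i ≡ 0

  InY : Fin k → Vecℕ k → Vecℕ k → Set
  InY i z y = (φ y ≋ φ z) × (y · z ≡ 0) × (1 ≤ y i)

  MinYIs : Fin k → Vecℕ k → ℕ → Set
  MinYIs i z n = (∃[ y ] (InY i z y × ∣ y ∣ ≡ n)) × (∀ y → InY i z y → n ≤ ∣ y ∣)

  IsMaxOverH : Fin k → ℕ → Set
  IsMaxOverH i m =
    (∀ z → InH i z → (∣ z ∣ ≤ m) × ∃[ n ] (MinYIs i z n × n ≤ m))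
    × (∃[ z ] (InH i z × (∣ z ∣ ≡ m ⊎ MinYIs i z m)))

module Submission where

-- With S = {x : Ax ≥ α_i}, H the minimal elements of S with x_i = 0 and
-- Y(z) = {y : Ay = Az, y·z = 0, y_i ≥ 1}, let M be the least number such that every
-- z ∈ H has |z| ≤ M and some y ∈ Y(z) with |y| ≤ M.  Upper bound: a factorization z
-- of γ ≥ α_i either uses α_i or lies above some h ∈ H, and z − h + y (y ∈ Y(h)) uses
-- α_i at distance ≤ M.  Lower bound: for the z ∈ H attaining M, fullness makes Az
-- admissible, and every factorization w of Az using α_i is disjoint from z (by
-- minimality), so w ∈ Y(z) and dist(z, w) ≥ max(|z|, |w|) ≥ M.
-- Everything is constructive: H lies in the box [0, ∑ α_i]^k and factorization sets
-- are finite, so all predicates are decidable by bounded search.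

open import Defs
open import Data.Nat using (ℕ)
open import Data.Fin using (Fin)
open import Data.Product using (∃-syntax; _×_)
open import Relation.Nullary using (¬_)

open import Data.Nat using (zero; suc; _+_; _*_; _∸_; _≤_; _<_; _⊔_; _⊓_; z≤n; s≤s; s≤s⁻¹; _≤?_; _≟_; ≢-nonZero)
open import Data.Nat.Properties
open import Data.Nat.Induction using (<-rec)
open import Data.Integer as ℤ using (ℤ)
import Data.Integer.Properties as ℤP
open import Data.Integer.Solver using (module +-*-Solver)
open import Data.Fin using (zero; suc)
open import Data.Fin.Properties using (all?; ¬∀⟶∃¬)
open import Data.Vec.Functional using ([]; _∷_; head; tail)
open import Data.Product using (∃; _,_; proj₁; proj₂)
open import Data.Sum using (_⊎_; inj₁; inj₂) renaming (map to ⊎-map)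
open import Data.Empty using (⊥-elim)
open import Function using (_∘_; const)
open import Relation.Nullary using (Dec; yes; no; ¬?)
open import Relation.Nullary.Decidable using (map′; _×-dec_; _⊎-dec_; _→-dec_; decidable-stable)
open import Relation.Unary using (Decidable)
open import Relation.Binary.PropositionalEquality
open import Algebra.Properties.CommutativeSemigroup +-commutativeSemigroup using (interchange)

≋-sym : ∀ {n} {x y : Vecℕ n} → x ≋ y → y ≋ x
≋-sym x≋y l = sym (x≋y l)

∑-cong : ∀ {n} {f g : Vecℕ n} → f ≋ g → ∑ f ≡ ∑ g
∑-cong {zero}  _   = refl
∑-cong {suc n} f≋g = cong₂ _+_ (f≋g zero) (∑-cong (f≋g ∘ suc))

∑-+ : ∀ {n} (f g : Vecℕ n) → ∑ (λ j → f j + g j) ≡ ∑ f + ∑ g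
∑-+ {zero}  f g = refl
∑-+ {suc n} f g = trans (cong (f zero + g zero +_) (∑-+ (f ∘ suc) (g ∘ suc)))
                        (interchange (f zero) (g zero) (∑ (f ∘ suc)) (∑ (g ∘ suc)))

∑-zero : ∀ {n} {f : Vecℕ n} → (∀ j → f j ≡ 0) → ∑ f ≡ 0
∑-zero {zero}  _  = refl
∑-zero {suc n} f0 = cong₂ _+_ (f0 zero) (∑-zero (f0 ∘ suc))

∑-mono : ∀ {n} {f g : Vecℕ n} → f ≤ᵥ g → ∑ f ≤ ∑ g
∑-mono {zero}  _   = z≤n
∑-mono {suc n} f≤g = +-mono-≤ (f≤g zero) (∑-mono (f≤g ∘ suc))

term≤∑ : ∀ {n} (f : Vecℕ n) j → f j ≤ ∑ f
term≤∑ f zero    = m≤m+n (f zero) _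
term≤∑ f (suc j) = ≤-trans (term≤∑ (f ∘ suc) j) (m≤n+m _ (f zero))

∑-tight : ∀ {n} {f g : Vecℕ n} → f ≤ᵥ g → ∑ g ≤ ∑ f → f ≋ g
∑-tight {suc n} {f} {g} f≤g ∑g≤∑f = λ { zero → ≤-antisym (f≤g zero) g₀≤f₀
                                      ; (suc j) → ∑-tight (f≤g ∘ suc) tail≤ j }
  where
  g₀≤f₀ : g zero ≤ f zero
  g₀≤f₀ = +-cancelʳ-≤ _ _ _ (≤-trans ∑g≤∑f (+-monoʳ-≤ (f zero) (∑-mono (f≤g ∘ suc))))
  tail≤ : ∑ (g ∘ suc) ≤ ∑ (f ∘ suc)
  tail≤ = +-cancelˡ-≤ (g zero) _ _ (≤-trans ∑g≤∑f (+-monoˡ-≤ _ (f≤g zero)))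

size⇒cube : ∀ {n} {y : Vecℕ n} {m} → ∣ y ∣ ≤ m → y ≤ᵥ const m
size⇒cube {y = y} ∣y∣≤m j = ≤-trans (term≤∑ y j) ∣y∣≤m

δ : ∀ {k} → Fin k → Vecℕ k
δ zero    zero    = 1
δ zero    (suc l) = 0
δ (suc i) zero    = 0
δ (suc i) (suc l) = δ i l

δ-diag : ∀ {k} (i : Fin k) → δ i i ≡ 1
δ-diag zero    = refl
δ-diag (suc i) = δ-diag i

∑-δ : ∀ {k} (i : Fin k) (a : Vecℕ k) → ∑ (λ j → δ i j * a j) ≡ a i
∑-δ zero    a = trans (cong₂ _+_ (*-identityˡ (a zero)) (∑-zero {f = λ j → δ zero (suc j) * a (suc j)} (λ _ → refl)))
                      (+-identityʳ _)
∑-δ (suc i) a = ∑-δ i (a ∘ suc)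

δ≤ : ∀ {k} (z : Vecℕ k) j → 1 ≤ z j → δ j ≤ᵥ z
δ≤ z zero    1≤zj zero    = 1≤zj
δ≤ z zero    _    (suc l) = z≤n
δ≤ z (suc j) _    zero    = z≤n
δ≤ z (suc j) 1≤zj (suc l) = δ≤ (z ∘ suc) j 1≤zj l

-- Bounded search.  A predicate on vectors is extensional if it respects pointwise
-- equality (vectors are functions, so this is not automatic).

Extensional : ∀ {k} → (Vecℕ k → Set) → Set
Extensional P = ∀ {x y} → x ≋ y → P x → P y

∷-cong : ∀ {k} (a : ℕ) {x y : Vecℕ k} → x ≋ y → (a ∷ x) ≋ (a ∷ y)
∷-cong a x≋y zero    = refl
∷-cong a x≋y (suc l) = x≋y l

head∷tail : ∀ {k} (z : Vecℕ (suc k)) → z ≋ (head z ∷ tail z)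
head∷tail z zero    = refl
head∷tail z (suc l) = refl

≋? : ∀ {n} (x y : Vecℕ n) → Dec (x ≋ y)
≋? x y = all? (λ l → x l ≟ y l)

≤ᵥ? : ∀ {n} (x y : Vecℕ n) → Dec (x ≤ᵥ y)
≤ᵥ? x y = all? (λ l → x l ≤? y l)

∃≤? : ∀ {k} (B : Vecℕ k) {P : Vecℕ k → Set} → Extensional P → Decidable P →
      Dec (∃[ z ] (z ≤ᵥ B × P z))
∃≤? {zero} B ext P? = map′ (λ p → [] , (λ ()) , p) (λ (_ , _ , p) → ext (λ ()) p) (P? [])
∃≤? {suc k} B {P} ext P? =
  map′ from to (anyUpTo? (λ a → ∃≤? (tail B) (ext ∘ ∷-cong a) (P? ∘ (a ∷_))) (suc (head B)))
  where
  from : ∃ (λ a → a < suc (head B) × ∃[ t ] (t ≤ᵥ tail B × P (a ∷ t))) → ∃[ z ] (z ≤ᵥ B × P z)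
  from (a , a<1+B₀ , t , t≤ , p) = a ∷ t , (λ { zero → s≤s⁻¹ a<1+B₀ ; (suc l) → t≤ l }) , p
  to : ∃[ z ] (z ≤ᵥ B × P z) → ∃ (λ a → a < suc (head B) × ∃[ t ] (t ≤ᵥ tail B × P (a ∷ t)))
  to (z , z≤B , p) = head z , s≤s (z≤B zero) , tail z , z≤B ∘ suc , ext (head∷tail z) p

∀≤? : ∀ {k} (B : Vecℕ k) {P : Vecℕ k → Set} → Extensional P → Decidable P →
      Dec (∀ z → z ≤ᵥ B → P z)
∀≤? B ext P? =
  map′ (λ none z z≤B → decidable-stable (P? z) (λ ¬p → none (z , z≤B , ¬p)))
       (λ all (z , z≤B , ¬p) → ¬p (all z z≤B))
       (¬? (∃≤? B (λ x≋y ¬px py → ¬px (ext (≋-sym x≋y) py)) (¬? ∘ P?)))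

∃bySize? : ∀ {k} {P : Vecℕ k → Set} {R : ℕ → Set} (m : ℕ) → (∀ {n} → R n → n ≤ m) →
           Extensional P → Decidable P → Decidable R → Dec (∃[ y ] (P y × R ∣ y ∣))
∃bySize? {R = R} m R⇒≤m ext P? R? =
  map′ (λ (y , _ , py , r) → y , py , r) (λ (y , py , r) → y , size⇒cube (R⇒≤m r) , py , r)
       (∃≤? (const m) (λ x≋y (px , r) → ext x≋y px , subst R (∑-cong x≋y) r)
            (λ y → P? y ×-dec R? ∣ y ∣))

least : {P : ℕ → Set} → Decidable P → ∀ M → P M → ∃[ N ] (P N × (∀ N' → P N' → N ≤ N'))
least {P} P? = <-rec (λ M → P M → ∃[ N ] (P N × (∀ N' → P N' → N ≤ N'))) step
  where
  step : ∀ M → (∀ {n} → n < M → P n → ∃[ N ] (P N × (∀ N' → P N' → N ≤ N'))) →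
         P M → ∃[ N ] (P N × (∀ N' → P N' → N ≤ N'))
  step M below pM with anyUpTo? P? M
  ... | yes (n , n<M , pn) = below n<M pn
  ... | no none = M , pM , λ N' pN' → ≮⇒≥ (λ N'<M → none (N' , N'<M , pN'))

leastSize : ∀ {k} {P : Vecℕ k → Set} → Extensional P → Decidable P → ∀ y → P y →
            ∃[ y* ] (P y* × (∀ y' → P y' → ∣ y* ∣ ≤ ∣ y' ∣))
leastSize ext P? y py with least (λ n → ∃bySize? n ≤-reflexive ext P? (_≟ n)) ∣ y ∣ (y , py , refl)
... | _ , (y* , py* , refl) , minimal = y* , py* , λ y' py' → minimal ∣ y' ∣ (y' , py' , refl)

uniformBoundℕ : ∀ n (R : ℕ → ℕ → Set) → (∀ {a m m'} → m ≤ m' → R a m → R a m') →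
                (∀ a → ∃[ m ] R a m) → ∃[ m ] (∀ a → a ≤ n → R a m)
uniformBoundℕ zero R mono f = proj₁ (f 0) , λ { zero _ → proj₂ (f 0) }
uniformBoundℕ (suc n) R mono f = m₁ ⊔ m₂ , bound
  where
  m₁ = proj₁ (uniformBoundℕ n R mono f)
  m₂ = proj₁ (f (suc n))
  bound : ∀ a → a ≤ suc n → R a (m₁ ⊔ m₂)
  bound a a≤1+n with m≤n⇒m<n∨m≡n a≤1+n
  ... | inj₁ a<1+n = mono (m≤m⊔n m₁ m₂) (proj₂ (uniformBoundℕ n R mono f) a (s≤s⁻¹ a<1+n))
  ... | inj₂ refl  = mono (m≤n⊔m m₁ m₂) (proj₂ (f (suc n)))

uniformBound : ∀ {k} (B : Vecℕ k) (R : Vecℕ k → ℕ → Set) →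
               (∀ {x y m} → x ≋ y → R x m → R y m) → (∀ {z m m'} → m ≤ m' → R z m → R z m') →
               (∀ z → ∃[ m ] R z m) → ∃[ m ] (∀ z → z ≤ᵥ B → R z m)
uniformBound {zero} B R ext mono f = proj₁ (f []) , λ z _ → ext (λ ()) (proj₂ (f []))
uniformBound {suc k} B R ext mono f = m , λ z z≤B →
  ext (≋-sym (head∷tail z)) (bound (head z) (z≤B zero) (tail z) (z≤B ∘ suc))
  where
  slices = uniformBoundℕ (head B) (λ a m → ∀ t → t ≤ᵥ tail B → R (a ∷ t) m)
             (λ m≤m' r t t≤ → mono m≤m' (r t t≤))
             (λ a → uniformBound (tail B) (R ∘ (a ∷_)) (ext ∘ ∷-cong a) mono (f ∘ (a ∷_)))
  m = proj₁ slices
  bound = proj₂ slices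

∑ℤ-cong : ∀ {n} {f g : Fin n → ℤ} → (∀ j → f j ≡ g j) → ∑ℤ f ≡ ∑ℤ g
∑ℤ-cong {zero}  _   = refl
∑ℤ-cong {suc n} f≡g = cong₂ ℤ._+_ (f≡g zero) (∑ℤ-cong (f≡g ∘ suc))

∑ℤ-pos : ∀ {n} (f : Vecℕ n) → ∑ℤ (λ j → ℤ.+ f j) ≡ ℤ.+ ∑ f
∑ℤ-pos {zero}  f = refl
∑ℤ-pos {suc n} f = trans (cong (λ t → ℤ.+ f zero ℤ.+ t) (∑ℤ-pos (f ∘ suc))) (sym (ℤP.pos-+ (f zero) _))

∑ℤ-− : ∀ {n} (f g : Fin n → ℤ) → ∑ℤ (λ j → f j ℤ.- g j) ≡ ∑ℤ f ℤ.- ∑ℤ g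
∑ℤ-− {zero}  f g = refl
∑ℤ-− {suc n} f g = trans (cong (λ t → f zero ℤ.- g zero ℤ.+ t) (∑ℤ-− (f ∘ suc) (g ∘ suc)))
  (solve 4 (λ a b c e → (a :- b) :+ (c :- e) := (a :+ c) :- (b :+ e)) refl
     (f zero) (g zero) (∑ℤ (f ∘ suc)) (∑ℤ (g ∘ suc)))
  where open +-*-Solver

pos-−-* : ∀ a b c → (ℤ.+ a ℤ.- ℤ.+ b) ℤ.* ℤ.+ c ≡ ℤ.+ (a * c) ℤ.- ℤ.+ (b * c)
pos-−-* a b c rewrite ℤP.pos-* a c | ℤP.pos-* b c =
  solve 3 (λ x y w → (x :- y) :* w := x :* w :- y :* w) refl (ℤ.+ a) (ℤ.+ b) (ℤ.+ c)
  where open +-*-Solver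

module Factorizations {d k : ℕ} (α : Fin k → Vecℕ d) where

  φ-cong : ∀ {x y} → x ≋ y → φ α x ≋ φ α y
  φ-cong x≋y l = ∑-cong (λ j → cong (_* α j l) (x≋y j))

  φ-+ : ∀ x y l → φ α (λ j → x j + y j) l ≡ φ α x l + φ α y l
  φ-+ x y l = trans (∑-cong (λ j → *-distribʳ-+ (α j l) (x j) (y j)))
                    (∑-+ (λ j → x j * α j l) (λ j → y j * α j l))

  φ-∸ : ∀ z m → m ≤ᵥ z → ∀ l → φ α (λ j → z j ∸ m j) l + φ α m l ≡ φ α z l
  φ-∸ z m m≤z l = trans (sym (φ-+ (λ j → z j ∸ m j) m l)) (φ-cong (λ j → m∸n+n≡m (m≤z j)) l)

  φ-δ : ∀ j l → φ α (δ j) l ≡ α j l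
  φ-δ j l = ∑-δ j (λ j' → α j' l)

  φ-term : ∀ v j l → v j * α j l ≤ φ α v l
  φ-term v j l = term≤∑ (λ j' → v j' * α j' l) j

  φ-uses : ∀ v j → 1 ≤ v j → α j ≤ᵥ φ α v
  φ-uses v j 1≤vj l = ≤-trans (≤-trans (≤-reflexive (sym (*-identityˡ (α j l)))) (*-monoˡ-≤ (α j l) 1≤vj))
                              (φ-term v j l)

  NonzeroGenerators : Set
  NonzeroGenerators = ∀ j → ¬ (∀ l → α j l ≡ 0)

  factorizationBound : NonzeroGenerators → ∀ {γ} z → φ α z ≋ γ → z ≤ᵥ const (∑ γ)
  factorizationBound nonzero {γ} z z∈Zγ j with ¬∀⟶∃¬ d (λ l → α j l ≡ 0) (λ l → α j l ≟ 0) (nonzero j)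
  ... | l , αjl≢0 = begin
    z j             ≤⟨ m≤m*n (z j) (α j l) {{≢-nonZero αjl≢0}} ⟩
    z j * α j l     ≤⟨ φ-term z j l ⟩
    φ α z l         ≡⟨ z∈Zγ l ⟩
    γ l             ≤⟨ term≤∑ γ l ⟩
    ∑ γ             ∎
    where open ≤-Reasoning

  factorization-ext : ∀ γ → Extensional (λ z → φ α z ≋ γ)
  factorization-ext γ x≋y x∈Zγ l = trans (sym (φ-cong x≋y l)) (x∈Zγ l)

  ∃Z? : NonzeroGenerators → ∀ γ {P : Vecℕ k → Set} → Extensional P → Decidable P →
        Dec (∃[ w ] (φ α w ≋ γ × P w))
  ∃Z? nonzero γ ext P? =
    map′ (λ (w , _ , w∈Zγ , p) → w , w∈Zγ , p)
         (λ (w , w∈Zγ , p) → w , factorizationBound nonzero w w∈Zγ , w∈Zγ , p)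
         (∃≤? (const (∑ γ)) (λ x≋y (x∈Zγ , px) → factorization-ext γ x≋y x∈Zγ , ext x≋y px)
              (λ w → ≋? (φ α w) γ ×-dec P? w))

  ∀Z? : NonzeroGenerators → ∀ γ {P : Vecℕ k → Set} → Extensional P → Decidable P →
        Dec (∀ z → φ α z ≋ γ → P z)
  ∀Z? nonzero γ ext P? =
    map′ (λ all z z∈Zγ → all z (factorizationBound nonzero z z∈Zγ) z∈Zγ) (λ all z _ → all z)
         (∀≤? (const (∑ γ)) (λ x≋y f y∈Zγ → ext x≋y (f (factorization-ext γ (≋-sym x≋y) y∈Zγ)))
              (λ z → ≋? (φ α z) γ →-dec P? z))

  Disjoint : Vecℕ k → Vecℕ k → Set
  Disjoint z w = ∀ l → z l ⊓ w l ≡ 0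

  disjoint⇒·≡0 : ∀ {z w} → Disjoint z w → w · z ≡ 0
  disjoint⇒·≡0 {z} {w} z⊥w = ∑-zero (λ j → product0 (z j) (w j) (z⊥w j))
    where
    product0 : ∀ a b → a ⊓ b ≡ 0 → b * a ≡ 0
    product0 zero    b       _ = *-zeroʳ b
    product0 (suc a) zero    _ = refl

  dist-cong : ∀ {z z' w w'} → z ≋ z' → w ≋ w' → dist α z w ≡ dist α z' w'
  dist-cong z≋z' w≋w' = cong₂ _⊔_
    (∑-cong (λ l → cong₂ (λ a b → a ∸ (a ⊓ b)) (z≋z' l) (w≋w' l)))
    (∑-cong (λ l → cong₂ (λ a b → b ∸ (a ⊓ b)) (z≋z' l) (w≋w' l)))

  dist-self : ∀ z → dist α z z ≡ 0
  dist-self z = cong₂ _⊔_ self0 self0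
    where
    self0 : ∑ (λ l → z l ∸ (z l ⊓ z l)) ≡ 0
    self0 = ∑-zero (λ l → trans (cong (z l ∸_) (⊓-idem (z l))) (n∸n≡0 (z l)))

  dist-disjoint : ∀ z w → Disjoint z w → (∣ z ∣ ≤ dist α z w) × (∣ w ∣ ≤ dist α z w)
  dist-disjoint z w z⊥w =
    ≤-trans (≤-reflexive (∑-cong (λ l → cong (z l ∸_) (sym (z⊥w l))))) (m≤m⊔n _ _) ,
    ≤-trans (≤-reflexive (∑-cong (λ l → cong (w l ∸_) (sym (z⊥w l))))) (m≤n⊔m _ _)

  ∸-⊓ : ∀ a b → a ∸ (a ⊓ b) ≡ a ∸ b
  ∸-⊓ zero    b       = trans (0∸n≡0 (0 ⊓ b)) (sym (0∸n≡0 b))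
  ∸-⊓ (suc a) zero    = refl
  ∸-⊓ (suc a) (suc b) = ∸-⊓ a b

  dist-replace : ∀ z m y → m ≤ᵥ z → dist α z (λ l → (z l ∸ m l) + y l) ≤ ∣ m ∣ ⊔ ∣ y ∣
  dist-replace z m y m≤z = ⊔-mono-≤ (∑-mono removed) (∑-mono added)
    where
    removed : ∀ l → z l ∸ (z l ⊓ ((z l ∸ m l) + y l)) ≤ m l
    removed l = begin
      z l ∸ (z l ⊓ ((z l ∸ m l) + y l)) ≡⟨ ∸-⊓ (z l) _ ⟩
      z l ∸ ((z l ∸ m l) + y l)         ≤⟨ ∸-monoʳ-≤ (z l) (m≤m+n (z l ∸ m l) (y l)) ⟩
      z l ∸ (z l ∸ m l)                 ≡⟨ m∸[m∸n]≡n (m≤z l) ⟩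
      m l                               ∎
      where open ≤-Reasoning
    added : ∀ l → ((z l ∸ m l) + y l) ∸ (z l ⊓ ((z l ∸ m l) + y l)) ≤ y l
    added l = begin
      ((z l ∸ m l) + y l) ∸ (z l ⊓ ((z l ∸ m l) + y l)) ≡⟨ cong (((z l ∸ m l) + y l) ∸_) (⊓-comm (z l) _) ⟩
      ((z l ∸ m l) + y l) ∸ (((z l ∸ m l) + y l) ⊓ z l) ≡⟨ ∸-⊓ _ (z l) ⟩
      ((z l ∸ m l) + y l) ∸ z l                         ≤⟨ ∸-monoˡ-≤ (z l) (+-monoˡ-≤ (y l) (m∸n≤m (z l) (m l))) ⟩
      (z l + y l) ∸ z l                                 ≡⟨ m+n∸m≡n (z l) (y l) ⟩
      y l                                               ∎
      where open ≤-Reasoning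

module Tameness {d k : ℕ} (α : Fin k → Vecℕ d) (i : Fin k) where

  open Factorizations α

  InS? : Decidable (InS α i)
  InS? x = all? (λ l → α i l ≤? φ α x l)

  InS-ext : Extensional (InS α i)
  InS-ext x≋y x∈S l = ≤-trans (x∈S l) (≤-reflexive (φ-cong x≋y l))

  InH-ext : Extensional (InH α i)
  InH-ext x≋y (x∈S , x-min , xi≡0) =
    InS-ext x≋y x∈S ,
    (λ u u∈S u≤y l → trans (x-min u u∈S (λ l' → ≤-trans (u≤y l') (≤-reflexive (sym (x≋y l')))) l) (x≋y l)) ,
    trans (sym (x≋y i)) xi≡0

  InH? : Decidable (InH α i)
  InH? z = InS? z ×-dec minimal? ×-dec (z i ≟ 0)
    where
    minimal? : Dec (∀ x → InS α i x → x ≤ᵥ z → x ≋ z)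
    minimal? = map′ (λ f x x∈S x≤z → f x x≤z x∈S) (λ f x x≤z x∈S → f x x∈S x≤z)
      (∀≤? z (λ x≋y f y∈S l → trans (sym (x≋y l)) (f (InS-ext (≋-sym x≋y) y∈S) l))
             (λ x → InS? x →-dec ≋? x z))

  minimalBelow : ∀ z → InS α i z → ∃[ m ] (m ≤ᵥ z × InS α i m × (∀ x → InS α i x → x ≤ᵥ m → x ≋ m))
  minimalBelow z z∈S
    with leastSize (λ x≋y (x≤z , x∈S) → (λ l → ≤-trans (≤-reflexive (sym (x≋y l))) (x≤z l)) , InS-ext x≋y x∈S)
                   (λ x → ≤ᵥ? x z ×-dec InS? x) z ((λ _ → ≤-refl) , z∈S)
  ... | m , (m≤z , m∈S) , smallest =
    m , m≤z , m∈S , λ x x∈S x≤m → ∑-tight x≤m (smallest x ((λ l → ≤-trans (x≤m l) (m≤z l)) , x∈S))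

  usesOrAboveH : ∀ z → InS α i z → (0 < z i) ⊎ ∃[ h ] (InH α i h × h ≤ᵥ z)
  usesOrAboveH z z∈S with z i ≟ 0
  ... | no zi≢0 = inj₁ (n≢0⇒n>0 zi≢0)
  ... | yes zi≡0 with minimalBelow z z∈S
  ...   | m , m≤z , m∈S , m-min = inj₂ (m , (m∈S , m-min , n≤0⇒n≡0 (subst (m i ≤_) zi≡0 (m≤z i))) , m≤z)

  -- H is finite: it lies in the cube [0, ∑ α_i]^k.  If z_j > ∑ α_i then z − e_j is
  -- still in S, contradicting minimality.
  H-bounded : ∀ z → InH α i z → z ≤ᵥ const (∑ (α i))
  H-bounded z (z∈S , z-min , _) j with z j ≤? ∑ (α i)
  ... | yes zj≤A = zj≤A
  ... | no zj≰A = ⊥-elim (1+n≢0 (trans (sym (δ-diag j)) unit-removed))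
    where
    A = ∑ (α i)
    1+A≤zj : suc A ≤ z j
    1+A≤zj = ≰⇒> zj≰A
    e≤z : δ j ≤ᵥ z
    e≤z = δ≤ z j (≤-trans (s≤s z≤n) 1+A≤zj)
    x : Vecℕ k
    x l = z l ∸ δ j l
    A≤xj : A ≤ x j
    A≤xj = subst (λ e → A ≤ z j ∸ e) (sym (δ-diag j)) (∸-monoˡ-≤ 1 1+A≤zj)
    x∈S : InS α i x
    x∈S l with α j l ≟ 0
    ... | yes αjl≡0 = begin
      α i l                    ≤⟨ z∈S l ⟩
      φ α z l                  ≡⟨ sym (φ-∸ z (δ j) e≤z l) ⟩
      φ α x l + φ α (δ j) l    ≡⟨ cong (φ α x l +_) (trans (φ-δ j l) αjl≡0) ⟩
      φ α x l + 0              ≡⟨ +-identityʳ _ ⟩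
      φ α x l                  ∎
      where open ≤-Reasoning
    ... | no αjl≢0 = begin
      α i l          ≤⟨ term≤∑ (α i) l ⟩
      A              ≤⟨ A≤xj ⟩
      x j            ≤⟨ m≤m*n (x j) (α j l) {{≢-nonZero αjl≢0}} ⟩
      x j * α j l    ≤⟨ φ-term x j l ⟩
      φ α x l        ∎
      where open ≤-Reasoning
    unit-removed : δ j j ≡ 0
    unit-removed = ∸-cancelˡ-≡ (e≤z j) z≤n (z-min x x∈S (λ l → m∸n≤m (z l) (δ j l)) j)

  ∃H? : {P : Vecℕ k → Set} → Extensional P → Decidable P → Dec (∃[ z ] (InH α i z × P z))
  ∃H? ext P? = map′ (λ (z , _ , pz) → z , pz) (λ (z , z∈H , p) → z , H-bounded z z∈H , z∈H , p)
    (∃≤? (const (∑ (α i))) (λ x≋y (x∈H , px) → InH-ext x≋y x∈H , ext x≋y px) (λ z → InH? z ×-dec P? z))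

  ∀H? : {P : Vecℕ k → Set} → Extensional P → Decidable P → Dec (∀ z → InH α i z → P z)
  ∀H? ext P? = map′ (λ all z z∈H → all z (H-bounded z z∈H) z∈H) (λ all z _ → all z)
    (∀≤? (const (∑ (α i))) (λ x≋y f y∈H → ext x≋y (f (InH-ext (≋-sym x≋y) y∈H))) (λ z → InH? z →-dec P? z))

  -- An element of H is disjoint from every factorization of Az that uses α_i:
  -- removing their gcd g from z leaves an element of S below z, so g = 0.
  disjoint : ∀ z w → InH α i z → φ α w ≋ φ α z → 1 ≤ w i → Disjoint z w
  disjoint z w (z∈S , z-min , zi≡0) w∈Z 1≤wi l =
    ∸-cancelˡ-≡ (m⊓n≤m (z l) (w l)) z≤n (z-min x x∈S (λ l → m∸n≤m (z l) (g l)) l)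
    where
    g x u : Vecℕ k
    g l = z l ⊓ w l
    x l = z l ∸ g l
    u l = w l ∸ g l
    φx≡φu : ∀ l → φ α x l ≡ φ α u l
    φx≡φu l = +-cancelʳ-≡ (φ α g l) _ _
      (trans (φ-∸ z g (λ j → m⊓n≤m (z j) (w j)) l)
      (trans (sym (w∈Z l)) (sym (φ-∸ w g (λ j → m⊓n≤n (z j) (w j)) l))))
    1≤ui : 1 ≤ u i
    1≤ui rewrite zi≡0 = 1≤wi
    x∈S : InS α i x
    x∈S l = ≤-trans (φ-uses u i 1≤ui l) (≤-reflexive (sym (φx≡φu l)))

  InY-ext : ∀ z → Extensional (InY α i z)
  InY-ext z x≋y (φx≡φz , x·z≡0 , 1≤xi) =
    (λ l → trans (sym (φ-cong x≋y l)) (φx≡φz l)) ,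
    trans (∑-cong (λ j → cong (_* z j) (sym (x≋y j)))) x·z≡0 ,
    ≤-trans 1≤xi (≤-reflexive (x≋y i))

  InY-ext-z : ∀ y {z z'} → z ≋ z' → InY α i z y → InY α i z' y
  InY-ext-z y z≋z' (φy≡φz , y·z≡0 , 1≤yi) =
    (λ l → trans (φy≡φz l) (φ-cong z≋z' l)) ,
    trans (∑-cong (λ j → cong (y j *_) (sym (z≋z' j)))) y·z≡0 ,
    1≤yi

  InY? : ∀ z → Decidable (InY α i z)
  InY? z y = ≋? (φ α y) (φ α z) ×-dec ((y · z) ≟ 0) ×-dec (1 ≤? y i)

  smallY? : ∀ z m → Dec (∃[ y ] (InY α i z y × ∣ y ∣ ≤ m))
  smallY? z m = ∃bySize? m (λ le → le) (InY-ext z) (InY? z) (_≤? m)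

  minY : ∀ z y → InY α i z y → ∃[ n ] (MinYIs α i z n × n ≤ ∣ y ∣)
  minY z y y∈Y with leastSize (InY-ext z) (InY? z) y y∈Y
  ... | y* , y*∈Y , smallest = ∣ y* ∣ , ((y* , y*∈Y , refl) , smallest) , smallest y y∈Y

  BoundsH : ℕ → Set
  BoundsH M = ∀ z → InH α i z → (∣ z ∣ ≤ M) × ∃[ y ] (InY α i z y × ∣ y ∣ ≤ M)

  BoundsH? : Decidable BoundsH
  BoundsH? M = ∀H? (λ z≋z' (∣z∣≤M , y , y∈Y , ∣y∣≤M) →
                       subst (_≤ M) (∑-cong z≋z') ∣z∣≤M , y , InY-ext-z y z≋z' y∈Y , ∣y∣≤M)
                   (λ z → (∣ z ∣ ≤? M) ×-dec smallY? z M)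

  tameWithin : ∀ {M} → BoundsH M → ∀ γ → α i ≤ᵥ γ → TameBound α i γ M
  tameWithin bM γ αi≤γ z z∈Zγ with usesOrAboveH z (λ l → ≤-trans (αi≤γ l) (≤-reflexive (sym (z∈Zγ l))))
  ... | inj₁ 0<zi = z , z∈Zγ , 0<zi , ≤-trans (≤-reflexive (dist-self z)) z≤n
  ... | inj₂ (h , h∈H , h≤z) with bM h h∈H
  ...   | ∣h∣≤M , y , (φy≡φh , _ , 1≤yi) , ∣y∣≤M =
    w , w∈Zγ , ≤-trans 1≤yi (m≤n+m (y i) _) , ≤-trans (dist-replace z h y h≤z) (⊔-lub ∣h∣≤M ∣y∣≤M)
    where
    w : Vecℕ k
    w l = (z l ∸ h l) + y l
    w∈Zγ : φ α w ≋ γ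
    w∈Zγ l = begin
      φ α w l                                   ≡⟨ φ-+ (λ j → z j ∸ h j) y l ⟩
      φ α (λ j → z j ∸ h j) l + φ α y l         ≡⟨ cong (φ α (λ j → z j ∸ h j) l +_) (φy≡φh l) ⟩
      φ α (λ j → z j ∸ h j) l + φ α h l         ≡⟨ φ-∸ z h h≤z l ⟩
      φ α z l                                   ≡⟨ z∈Zγ l ⟩
      γ l                                       ∎
      where open ≡-Reasoning

  TameBound? : NonzeroGenerators → ∀ γ N → Dec (TameBound α i γ N)
  TameBound? nonzero γ N =
    ∀Z? nonzero γ {λ z → ∃[ w ] (φ α w ≋ γ × 0 < w i × dist α z w ≤ N)} (λ {z} {z'} z≋z' f → let (w , w∈Zγ , 0<wi , dist≤N) = f in
                     w , w∈Zγ , 0<wi , subst (_≤ N) (dist-cong {w = w} z≋z' (λ _ → refl)) dist≤N)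
      (λ z → ∃Z? nonzero γ {λ w → 0 < w i × dist α z w ≤ N} (λ {w} {w'} w≋w' (0<wi , dist≤N) →
                               ≤-trans 0<wi (≤-reflexive (w≋w' i)) ,
                               subst (_≤ N) (dist-cong {z} (λ _ → refl) w≋w') dist≤N)
                 (λ w → (1 ≤? w i) ×-dec (dist α z w ≤? N)))

  tiBoundedBy : NonzeroGenerators → ∀ {M} → BoundsH M → TiBoundedBy α i M
  tiBoundedBy nonzero {M} bM γ (αi≤γ , _) =
    let tameM = tameWithin bM γ αi≤γ
        (N , tameN , N-least) = least (TameBound? nonzero γ) M tameM
    in N , (tameN , N-least) , N-least M tameM

  -- Without elements of H every factorization of an admissible γ uses α_i.
  tiZero : ¬ (∃[ z ] InH α i z) → TiIs α i 0
  tiZero noH = (λ γ (αi≤γ , _) → 0 , (usesα γ αi≤γ , λ _ _ → z≤n) , z≤n) , λ _ _ → z≤n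
    where
    usesα : ∀ γ → α i ≤ᵥ γ → TameBound α i γ 0
    usesα γ αi≤γ z z∈Zγ with usesOrAboveH z (λ l → ≤-trans (αi≤γ l) (≤-reflexive (sym (z∈Zγ l))))
    ... | inj₁ 0<zi = z , z∈Zγ , 0<zi , ≤-reflexive (dist-self z)
    ... | inj₂ (h , h∈H , _) = ⊥-elim (noH (h , h∈H))

  Attained : ℕ → Set
  Attained M = ∃[ z ] (InH α i z × (∣ z ∣ ≡ M ⊎ MinYIs α i z M))

  maxAttained : ∃[ z ] InH α i z → ∀ M → BoundsH M → (∀ m → BoundsH m → M ≤ m) → Attained M
  maxAttained (z₀ , z₀∈H) zero bM _ = z₀ , z₀∈H , inj₁ (n≤0⇒n≡0 (proj₁ (bM z₀ z₀∈H)))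
  maxAttained _ (suc M) bM M-least
    with ∃H? (λ z≋z' → ⊎-map (trans (sym (∑-cong z≋z')))
                                    (λ none (y , y∈Y , ∣y∣≤M) → none (y , InY-ext-z y (≋-sym z≋z') y∈Y , ∣y∣≤M)))
             (λ z → (∣ z ∣ ≟ suc M) ⊎-dec ¬? (smallY? z M))
  ... | yes (z , z∈H , inj₁ ∣z∣≡1+M) = z , z∈H , inj₁ ∣z∣≡1+M
  ... | yes (z , z∈H , inj₂ noSmallY) = z , z∈H , inj₂ (minimum (proj₂ (bM z z∈H)))
    where
    large : ∀ y → InY α i z y → suc M ≤ ∣ y ∣
    large y y∈Y = ≰⇒> (λ ∣y∣≤M → noSmallY (y , y∈Y , ∣y∣≤M))
    minimum : ∃[ y ] (InY α i z y × ∣ y ∣ ≤ suc M) → MinYIs α i z (suc M)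
    minimum (y , y∈Y , ∣y∣≤1+M) = (y , y∈Y , ≤-antisym ∣y∣≤1+M (large y y∈Y)) , large
  ... | no none = ⊥-elim (1+n≰n (M-least M boundsM))
    where
    boundsM : BoundsH M
    boundsM z z∈H with smallY? z M
    ... | no noSmallY = ⊥-elim (none (z , z∈H , inj₂ noSmallY))
    ... | yes smallY  = s≤s⁻¹ (≤∧≢⇒< (proj₁ (bM z z∈H)) (λ ∣z∣≡1+M → none (z , z∈H , inj₁ ∣z∣≡1+M))) , smallY

  module _ (full : IsFull α) where

    -- Fullness: if Az ≥ α_i then Az − α_i ∈ Γ, with integer coefficients z − e_i.
    S⇒Γ : ∀ z → InS α i z → _∈Γ α (λ l → φ α z l ∸ α i l)
    S⇒Γ z z∈S = full (λ l → φ α z l ∸ α i l) ((λ j → ℤ.+ z j ℤ.- ℤ.+ δ i j) , combination)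
      where
      combination : ∀ l → ∑ℤ (λ j → (ℤ.+ z j ℤ.- ℤ.+ δ i j) ℤ.* ℤ.+ α j l) ≡ ℤ.+ (φ α z l ∸ α i l)
      combination l = begin
        ∑ℤ (λ j → (ℤ.+ z j ℤ.- ℤ.+ δ i j) ℤ.* ℤ.+ α j l)             ≡⟨ ∑ℤ-cong (λ j → pos-−-* (z j) (δ i j) (α j l)) ⟩
        ∑ℤ (λ j → ℤ.+ (z j * α j l) ℤ.- ℤ.+ (δ i j * α j l))       ≡⟨ ∑ℤ-− (λ j → ℤ.+ (z j * α j l)) (λ j → ℤ.+ (δ i j * α j l)) ⟩
        ∑ℤ (λ j → ℤ.+ (z j * α j l)) ℤ.- ∑ℤ (λ j → ℤ.+ (δ i j * α j l)) ≡⟨ cong₂ ℤ._-_ (∑ℤ-pos (λ j → z j * α j l)) (∑ℤ-pos (λ j → δ i j * α j l)) ⟩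
        ℤ.+ φ α z l ℤ.- ℤ.+ φ α (δ i) l                               ≡⟨ cong (λ t → ℤ.+ φ α z l ℤ.- ℤ.+ t) (φ-δ i l) ⟩
        ℤ.+ φ α z l ℤ.- ℤ.+ α i l                                     ≡⟨ ℤP.m-n≡m⊖n (φ α z l) (α i l) ⟩
        φ α z l ℤ.⊖ α i l                                         ≡⟨ ℤP.⊖-≥ (z∈S l) ⟩
        ℤ.+ (φ α z l ∸ α i l)                                       ∎
        where open ≡-Reasoning

    -- Y(z) is nonempty for z ∈ H: take a factorization of Az − α_i and add e_i.
    Y-nonempty : ∀ z → InH α i z → ∃[ y ] InY α i z y
    Y-nonempty z z∈H@(z∈S , _ , _) with S⇒Γ z z∈S
    ... | w , w∈Z = y , y∈Z , disjoint⇒·≡0 (disjoint z y z∈H y∈Z 1≤yi) , 1≤yi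
      where
      y : Vecℕ k
      y j = w j + δ i j
      y∈Z : φ α y ≋ φ α z
      y∈Z l = trans (φ-+ w (δ i) l) (trans (cong₂ _+_ (w∈Z l) (φ-δ i l)) (m∸n+n≡m (z∈S l)))
      1≤yi : 1 ≤ y i
      1≤yi = ≤-trans (≤-reflexive (sym (δ-diag i))) (m≤n+m (δ i i) (w i))

    -- Some M bounds the values over H, since H is finite and each Y(z) is nonempty.
    boundsH-exists : ∃[ M ] BoundsH M
    boundsH-exists =
      let (M , bound) = uniformBound (const (∑ (α i)))
                          (λ z m → InH α i z → (∣ z ∣ ≤ m) × ∃[ y ] (InY α i z y × ∣ y ∣ ≤ m))
                          (λ x≋y f y∈H → let (∣x∣≤m , w , w∈Y , ∣w∣≤m) = f (InH-ext (≋-sym x≋y) y∈H) in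
                             subst (_≤ _) (∑-cong x≋y) ∣x∣≤m , w , InY-ext-z w x≋y w∈Y , ∣w∣≤m)
                          (λ m≤m' f z∈H → let (∣z∣≤m , y , y∈Y , ∣y∣≤m) = f z∈H in
                             ≤-trans ∣z∣≤m m≤m' , y , y∈Y , ≤-trans ∣y∣≤m m≤m')
                          valueAt
      in M , λ z z∈H → bound z (H-bounded z z∈H) z∈H
      where
      valueAt : ∀ z → ∃[ m ] (InH α i z → (∣ z ∣ ≤ m) × ∃[ y ] (InY α i z y × ∣ y ∣ ≤ m))
      valueAt z with InH? z
      ... | no z∉H = 0 , λ z∈H → ⊥-elim (z∉H z∈H)
      ... | yes z∈H = let (y , y∈Y) = Y-nonempty z z∈H in
                      ∣ z ∣ ⊔ ∣ y ∣ , λ _ → m≤m⊔n _ _ , y , y∈Y , m≤n⊔m _ _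

    -- The lower bound: at the element z ∈ H attaining M, the admissible γ = Az
    -- forces t_i(γ) ≥ M, since every w ∈ Z(Az) with w_i > 0 is disjoint from z.
    tiAtLeast : ∀ M → Attained M → ∀ m → TiBoundedBy α i m → M ≤ m
    tiAtLeast M (z , z∈H@(z∈S , _ , _) , attains) m bounded
      with bounded (φ α z) (z∈S , S⇒Γ z z∈S)
    ... | N , (tameN , _) , N≤m with tameN z (λ _ → refl)
    ...   | w , w∈Z , 0<wi , dist≤N = ≤-trans (M≤dist attains) (≤-trans dist≤N N≤m)
      where
      z⊥w = disjoint z w z∈H w∈Z 0<wi
      M≤dist : ∣ z ∣ ≡ M ⊎ MinYIs α i z M → M ≤ dist α z w
      M≤dist (inj₁ ∣z∣≡M) = subst (_≤ dist α z w) ∣z∣≡M (proj₁ (dist-disjoint z w z⊥w))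
      M≤dist (inj₂ (_ , minimal)) =
        ≤-trans (minimal w (w∈Z , disjoint⇒·≡0 z⊥w , 0<wi)) (proj₂ (dist-disjoint z w z⊥w))

    tiMax : NonzeroGenerators → ∃[ z ] InH α i z → ∃[ m ] (TiIs α i m × IsMaxOverH α i m)
    tiMax nonzero H≠∅ = M , (tiBoundedBy nonzero bM , tiAtLeast M attained) , valuesBounded , attained
      where
      leastBound = least BoundsH? (proj₁ boundsH-exists) (proj₂ boundsH-exists)
      M = proj₁ leastBound
      bM = proj₁ (proj₂ leastBound)
      attained = maxAttained H≠∅ M bM (proj₂ (proj₂ leastBound))
      valuesBounded : ∀ z → InH α i z → (∣ z ∣ ≤ M) × ∃[ n ] (MinYIs α i z n × n ≤ M)
      valuesBounded z z∈H =
        let (∣z∣≤M , y , y∈Y , ∣y∣≤M) = bM z z∈H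
            (n , minimum , n≤∣y∣) = minY z y y∈Y
        in ∣z∣≤M , n , minimum , ≤-trans n≤∣y∣ ∣y∣≤M

theorem5p11 : (d k : ℕ) (α : Fin k → Vecℕ d) →
    IsMinimalGeneratingSet α → IsFull α → (i : Fin k) →
    ((¬ (∃[ z ] InH α i z)) → TiIs α i 0)
    × ((∃[ z ] InH α i z) → ∃[ m ] (TiIs α i m × IsMaxOverH α i m))
theorem5p11 d k α minimal full i = tiZero , tiMax full nonzero
  where
  open Tameness α i
  -- only the nonvanishing of the generators is needed from minimality
  nonzero : Factorizations.NonzeroGenerators α
  nonzero = proj₁ ∘ minimal
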